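{- Let $n\ge8$ and let $\mathcal{Z}\subseteq\{1,\dots,N\}$ be a set such that for all $m,\ell\in\mathcal{Z}$ and all $\delta\in\{ -1,0,1\}$ one has $\frac{n+1-\epsilon(n)}{2}\not\equiv 2(m-\ell)+\delta \pmod n$. Then for every $\ell\in\mathcal{Z}\setminus\{\lfloor n/4\rfloor,\lfloor n/4\rfloor+1\}$, the $\mathbb{R}$-linear span of $\mathfrak{B}_\ell$ has dimension $2n-1$.
   Context: For $1 \le i,j \le n$ let $\mathbf{c}_{i,j} \in \mathbb{R}^{2n+1}$ be the vector whose $k$-th coordinate ($1\le k\le n$) is $1$ if $k=i$ and $0$ otherwise, whose $(n+k)$-th coordinate ($1 \le k \le n-1$) is $1$ if $k=j$ and $0$ otherwise, whose $2n$-th coordinate is $1$ if $i=j$ and $0$ otherwise, and whose $(2n+1)$-th coordinate is $1$ if $i+j=n+1$ and $0$ otherwise. The second subscript is read modulo $n$: $\mathbf{c}_{i,j+mn}=\mathbf{c}_{i,j}$. Let $\epsilon(n)=1$ if $n$ is even and $0$ if $n$ is odd, and $N=\frac{n-1+\epsilon(n)}{2}-2$. For $0\le\ell\le N$ let $\widetilde{\mathfrak{B}}_\ell=\{\mathbf{c}_{i,i+2\ell}:1\le i\le n\}\cup(\{\mathbf{c}_{i,i+2\ell+1}:1\le i\le n\}\setminus\{\mathbf{c}_{n-2\ell-1,n}\})$. For $1\le\ell\le N$ let $i_1=i_1(\ell)=\frac{n+1-\epsilon(n)}{2}-\ell$, $i_2=i_2(\ell)=n-\ell$, and $$\mathfr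ak{B}_\ell=\Big(\widetilde{\mathfrak{B}}_\ell\setminus\{\mathbf{c}_{i_1,i_1+2\ell},\mathbf{c}_{i_1,i_1+2\ell+1},\mathbf{c}_{i_2,i_2+2\ell},\mathbf{c}_{i_2,i_2+2\ell+1}\}\Big)\cup\{\mathbf{c}_{i_1,i_2+2\ell},\mathbf{c}_{i_1,i_2+2\ell+1},\mathbf{c}_{i_2,i_1+2\ell},\mathbf{c}_{i_2,i_1+2\ell+1}\}.$$
   Formalization: The vectors $\mathbf{c}_{i,j}$ lie in ℚ^(2n+1), and the span of $\mathfrak{B}_\ell$ and its dimension are taken over ℚ rather than ℝ. -}

module Defs where

open import Data.Bool using (Bool; true; false; if_then_else_)
open import Data.Nat as ℕ using (ℕ; zero; suc; _+_; _*_; _∸_; _≤_; _≡ᵇ_; _≤ᵇ_; NonZero)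
open import Data.Nat.DivMod using (_/_; _%_)
open import Data.Fin using (Fin; toℕ)
import Data.Fin as Fin
open import Data.Integer as ℤ using (ℤ; +_)
open import Data.Integer.Divisibility as ℤD using ()
open import Data.Rational as ℚ using (ℚ; 0ℚ; 1ℚ)
open import Data.Product using (Σ; ∃; _×_)
open import Data.Sum using (_⊎_)
open import Relation.Nullary using (¬_)
open import Relation.Binary.PropositionalEquality using (_≡_; _≗_)

ε : ℕ → ℕ
ε n = 1 ∸ (n % 2)

half : ℕ → ℕ
half n = (n + 1 ∸ ε n) / 2

bigN : ℕ → ℕ
bigN n = ((n ∸ 1 + ε n) / 2) ∸ 2

-- representative of j modulo n in {1,…,n} (for j ≥ 1)
red : (n : ℕ) → .{{NonZero n}} → ℕ → ℕ
red n j = suc ((j ∸ 1) % n)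

-- vectors of ℚ^(2n+1), coordinates indexed by Fin (2n+1) (coordinate p ↔ index toℕ p + 1)
V : ℕ → Set
V n = Fin (suc (2 * n)) → ℚ

ind : Bool → ℚ
ind true = 1ℚ
ind false = 0ℚ

c : (n : ℕ) → .{{NonZero n}} → ℕ → ℕ → V n
c n i j p =
  let q  = suc (toℕ p)
      j' = red n j
  in if q ≤ᵇ n then ind (q ≡ᵇ i)
     else if q ≤ᵇ (2 * n ∸ 1) then ind ((q ∸ n) ≡ᵇ j')
     else if q ≡ᵇ 2 * n then ind (i ≡ᵇ j')
     else ind ((i + j') ≡ᵇ (n + 1))

VSet : ℕ → Set₁
VSet n = V n → Set

Btilde : (n : ℕ) → .{{NonZero n}} → ℕ → VSet n
Btilde n ℓ v =
  (∃ λ i → 1 ≤ i × i ≤ n × v ≗ c n i (i + 2 * ℓ))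
  ⊎ (∃ λ i → 1 ≤ i × i ≤ n × v ≗ c n i (i + 2 * ℓ + 1)
               × ¬ (v ≗ c n (n ∸ 2 * ℓ ∸ 1) n))

i₁ : ℕ → ℕ → ℕ
i₁ n ℓ = half n ∸ ℓ

i₂ : ℕ → ℕ → ℕ
i₂ n ℓ = n ∸ ℓ

B : (n : ℕ) → .{{NonZero n}} → ℕ → VSet n
B n ℓ v =
  (Btilde n ℓ v
    × ¬ (v ≗ c n a (a + 2 * ℓ)) × ¬ (v ≗ c n a (a + 2 * ℓ + 1))
    × ¬ (v ≗ c n b (b + 2 * ℓ)) × ¬ (v ≗ c n b (b + 2 * ℓ + 1)))
  ⊎ (v ≗ c n a (b + 2 * ℓ)) ⊎ (v ≗ c n a (b + 2 * ℓ + 1))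
  ⊎ (v ≗ c n b (a + 2 * ℓ)) ⊎ (v ≗ c n b (a + 2 * ℓ + 1))
  where
    a = i₁ n ℓ
    b = i₂ n ℓ

Σℚ : (m : ℕ) → (Fin m → ℚ) → ℚ
Σℚ zero f = 0ℚ
Σℚ (suc m) f = f Fin.zero ℚ.+ Σℚ m (λ k → f (Fin.suc k))


lincomb : (n : ℕ) (m : ℕ) → (Fin m → ℚ) → (Fin m → V n) → V n
lincomb n m a u p = Σℚ m (λ k → a k ℚ.* u k p)

InSpanOf : (n : ℕ) (m : ℕ) → (Fin m → V n) → V n → Set
InSpanOf n m u v = ∃ λ (a : Fin m → ℚ) → lincomb n m a u ≗ v

InSpan : {n : ℕ} → VSet n → V n → Set
InSpan {n} S v = ∃ λ (m : ℕ) → ∃ λ (u : Fin m → V n) → (∀ k → S (u k)) × InSpanOf n m u v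

LinIndep : (n : ℕ) (d : ℕ) → (Fin d → V n) → Set
LinIndep n d b = ∀ (a : Fin d → ℚ) → lincomb n d a b ≗ (λ _ → 0ℚ) → ∀ k → a k ≡ 0ℚ

SpanDim : (n : ℕ) → VSet n → ℕ → Set
SpanDim n S d = ∃ λ (b : Fin d → V n) →
  (∀ k → InSpan {n} S (b k)) × LinIndep n d b × (∀ v → S v → InSpanOf n d b v)

δ∈ : ℤ → Set
δ∈ δ = δ ≡ ℤ.-[1+ 0 ] ⊎ δ ≡ + 0 ⊎ δ ≡ + 1

NotCong : ℕ → ℕ → ℕ → Set
NotCong n m ℓ = ∀ δ → δ∈ δ →
  ¬ ((+ n) ℤD.∣ ((+ half n) ℤ.- ((+ 2) ℤ.* ((+ m) ℤ.- (+ ℓ)) ℤ.+ δ)))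

{-# OPTIONS --safe #-}

-- Read c_{i,j} as an edge between the row vertex i and the column vertex j (mod n) of a
-- bipartite graph on the 2n − 1 row and column coordinates (column n has no coordinate).
-- B̃_ℓ joins each row i to the columns i + 2ℓ and i + 2ℓ + 1 and omits the edge from row
-- i₀ = n − 2ℓ − 1 to column n, so it is a path with 2n − 1 edges from column n to row i₀;
-- 𝔅_ℓ exchanges the rows i₁ and i₂ along this path and is again such a path. Walking along
-- it from the column-n end, every edge reaches a row or column coordinate that no earlier
-- edge touches, so the vectors of 𝔅_ℓ are unitriangular, hence independent, and 𝔅_ℓ is a
-- basis of its own span.

module Submission where

open import Defs
import Data.Rational.Properties as ℚP
open import Algebra.Properties.CommutativeMonoid.Sum ℚP.+-0-commutativeMonoid
  using (sum; sum-cong-≗; sum-replicate-zero; sum-init-last)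
open import Data.Fin as Fin using (Fin; toℕ; fromℕ; fromℕ<; inject₁; lower₁)
open import Data.Fin.Properties
  using (toℕ-injective; toℕ-fromℕ; toℕ-fromℕ<; toℕ-inject₁; toℕ<n; inject₁ℕ<; inject₁-lower₁)
open import Data.Nat as ℕ
open import Data.Nat.DivMod using (_/_; _%_; m<n⇒m%n≡m; [m+n]%n≡m%n; [m+kn]%n≡m%n; m*n%n≡0; m*n/n≡m)
open import Data.Nat.Properties
open import Data.Nat.Tactic.RingSolver using (solve-∀)
open import Data.Product using (∃; _×_; _,_; proj₁; proj₂)
open import Data.Rational as ℚ using (ℚ; 0ℚ; 1ℚ)
open import Data.Sum as Sum using (_⊎_; inj₁; inj₂)
open import Function using (_∘_)
open import Relation.Nullary using (¬_; yes; no; contradiction)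
open import Relation.Nullary.Decidable using (dec-true; dec-false)
open import Relation.Binary.PropositionalEquality

Σℚ≡sum : ∀ m (f : Fin m → ℚ) → Σℚ m f ≡ sum f
Σℚ≡sum zero    f = refl
Σℚ≡sum (suc m) f = cong (f Fin.zero ℚ.+_) (Σℚ≡sum m (f ∘ Fin.suc))

Σℚ-zero : ∀ m (f : Fin m → ℚ) → (∀ k → f k ≡ 0ℚ) → Σℚ m f ≡ 0ℚ
Σℚ-zero m f f≡0 = trans (Σℚ≡sum m f) (trans (sum-cong-≗ f≡0) (sum-replicate-zero m))

lincomb-init-last : ∀ n d (α : Fin (suc d) → ℚ) (u : Fin (suc d) → V n) p →
  lincomb n (suc d) α u p ≡
  lincomb n d (α ∘ inject₁) (u ∘ inject₁) p ℚ.+ α (fromℕ d) ℚ.* u (fromℕ d) p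
lincomb-init-last n d α u p = begin
  Σℚ (suc d) term                            ≡⟨ Σℚ≡sum (suc d) term ⟩
  sum term                                   ≡⟨ sum-init-last term ⟩
  sum (term ∘ inject₁) ℚ.+ term (fromℕ d)
    ≡⟨ cong (ℚ._+ term (fromℕ d)) (Σℚ≡sum d (term ∘ inject₁)) ⟨
  Σℚ d (term ∘ inject₁) ℚ.+ term (fromℕ d)   ∎
  where
  open ≡-Reasoning
  term : Fin (suc d) → ℚ
  term k = α k ℚ.* u k p

linIndep-unitriangular : ∀ n d (u : Fin d → V n) →
  (∀ k → ∃ λ p → u k p ≡ 1ℚ × (∀ k′ → k′ Fin.< k → u k′ p ≡ 0ℚ)) →
  LinIndep n d u
linIndep-unitriangular n zero    u pivot α comb ()
linIndep-unitriangular n (suc d) u pivot α comb with pivot (fromℕ d)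
... | p , ulast-p≡1 , earlier-p≡0 = α≡0
  where
  open ≡-Reasoning
  last = fromℕ d

  initComb : V n
  initComb = lincomb n d (α ∘ inject₁) (u ∘ inject₁)

  initComb-p≡0 : initComb p ≡ 0ℚ
  initComb-p≡0 = Σℚ-zero d _ λ k → begin
    α (inject₁ k) ℚ.* u (inject₁ k) p
      ≡⟨ cong (α (inject₁ k) ℚ.*_) (earlier-p≡0 (inject₁ k) (inject₁<last k)) ⟩
    α (inject₁ k) ℚ.* 0ℚ
      ≡⟨ ℚP.*-zeroʳ (α (inject₁ k)) ⟩
    0ℚ ∎
    where
    inject₁<last : ∀ k → inject₁ k Fin.< last
    inject₁<last k = subst (toℕ (inject₁ k) <_) (sym (toℕ-fromℕ d)) (inject₁ℕ< k)

  αlast≡0 : α last ≡ 0ℚ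
  αlast≡0 = begin
    α last                               ≡⟨ ℚP.*-identityʳ (α last) ⟨
    α last ℚ.* 1ℚ                        ≡⟨ cong (α last ℚ.*_) ulast-p≡1 ⟨
    α last ℚ.* u last p                  ≡⟨ ℚP.+-identityˡ (α last ℚ.* u last p) ⟨
    0ℚ ℚ.+ α last ℚ.* u last p           ≡⟨ cong (ℚ._+ α last ℚ.* u last p) initComb-p≡0 ⟨
    initComb p ℚ.+ α last ℚ.* u last p   ≡⟨ lincomb-init-last n d α u p ⟨
    lincomb n (suc d) α u p              ≡⟨ comb p ⟩
    0ℚ                                   ∎

  initComb≡0 : initComb ≗ (λ _ → 0ℚ)
  initComb≡0 q = begin
    initComb q                           ≡⟨ ℚP.+-identityʳ (initComb q) ⟨
    initComb q ℚ.+ 0ℚ                    ≡⟨ cong (initComb q ℚ.+_) lastTerm≡0 ⟨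
    initComb q ℚ.+ α last ℚ.* u last q   ≡⟨ lincomb-init-last n d α u q ⟨
    lincomb n (suc d) α u q              ≡⟨ comb q ⟩
    0ℚ                                   ∎
    where
    lastTerm≡0 : α last ℚ.* u last q ≡ 0ℚ
    lastTerm≡0 = trans (cong (ℚ._* u last q) αlast≡0) (ℚP.*-zeroˡ (u last q))

  αinit≡0 : ∀ k → α (inject₁ k) ≡ 0ℚ
  αinit≡0 = linIndep-unitriangular n d (u ∘ inject₁) initPivot (α ∘ inject₁) initComb≡0
    where
    initPivot : ∀ k → ∃ λ p → u (inject₁ k) p ≡ 1ℚ × (∀ k′ → k′ Fin.< k → u (inject₁ k′) p ≡ 0ℚ)
    initPivot k with pivot (inject₁ k)
    ... | p , uk-p≡1 , earlier-p≡0 = p , uk-p≡1 , λ k′ k′<k →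
      earlier-p≡0 (inject₁ k′) (subst₂ _<_ (sym (toℕ-inject₁ k′)) (sym (toℕ-inject₁ k)) k′<k)

  α≡0 : ∀ k → α k ≡ 0ℚ
  α≡0 k with toℕ k ≟ d
  ... | yes k≡d = subst (λ k → α k ≡ 0ℚ) (toℕ-injective (trans (toℕ-fromℕ d) (sym k≡d))) αlast≡0
  ... | no k≢d  =
    subst (λ k → α k ≡ 0ℚ) (inject₁-lower₁ k (k≢d ∘ sym)) (αinit≡0 (lower₁ k (k≢d ∘ sym)))

δ : ∀ {d} → Fin d → Fin d → ℚ
δ Fin.zero    Fin.zero     = 1ℚ
δ Fin.zero    (Fin.suc _)  = 0ℚ
δ (Fin.suc _) Fin.zero     = 0ℚ
δ (Fin.suc k) (Fin.suc k′) = δ k k′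

lincomb-δ : ∀ n d (u : Fin d → V n) k → lincomb n d (δ k) u ≗ u k
lincomb-δ n (suc d) u Fin.zero p = begin
  1ℚ ℚ.* u Fin.zero p ℚ.+ Σℚ d (λ k → 0ℚ ℚ.* u (Fin.suc k) p)
    ≡⟨ cong₂ ℚ._+_ (ℚP.*-identityˡ (u Fin.zero p)) (Σℚ-zero d _ (λ k → ℚP.*-zeroˡ (u (Fin.suc k) p))) ⟩
  u Fin.zero p ℚ.+ 0ℚ
    ≡⟨ ℚP.+-identityʳ (u Fin.zero p) ⟩
  u Fin.zero p ∎
  where open ≡-Reasoning
lincomb-δ n (suc d) u (Fin.suc k) p = begin
  0ℚ ℚ.* u Fin.zero p ℚ.+ lincomb n d (δ k) (u ∘ Fin.suc) p
    ≡⟨ cong (ℚ._+ lincomb n d (δ k) (u ∘ Fin.suc) p) (ℚP.*-zeroˡ (u Fin.zero p)) ⟩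
  0ℚ ℚ.+ lincomb n d (δ k) (u ∘ Fin.suc) p
    ≡⟨ ℚP.+-identityˡ _ ⟩
  lincomb n d (δ k) (u ∘ Fin.suc) p
    ≡⟨ lincomb-δ n d (u ∘ Fin.suc) k p ⟩
  u (Fin.suc k) p ∎
  where open ≡-Reasoning

linIndep-enumeration⇒spanDim : ∀ n d (S : VSet n) (u : Fin d → V n) → LinIndep n d u →
  (∀ k → S (u k)) → (∀ v → S v → ∃ λ k → v ≗ u k) → SpanDim n S d
linIndep-enumeration⇒spanDim n d S u indep member cover =
  u , (λ k → 1 , (λ _ → u k) , (λ _ → member k) , δ Fin.zero , lincomb-δ n 1 (λ _ → u k) Fin.zero) ,
  indep , λ v Sv → let (k , v≗uk) = cover v Sv in δ k , λ p → trans (lincomb-δ n d u k p) (sym (v≗uk p))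

ind-≡ : ∀ {x y} → x ≡ y → ind (x ≡ᵇ y) ≡ 1ℚ
ind-≡ {x} {y} x≡y = cong ind (dec-true (x ≟ y) x≡y)

ind-≢ : ∀ {x y} → x ≢ y → ind (x ≡ᵇ y) ≡ 0ℚ
ind-≢ {x} {y} x≢y = cong ind (dec-false (x ≟ y) x≢y)

red-id : ∀ n .{{_ : NonZero n}} {j} → 1 ≤ j → j ≤ n → red n j ≡ j
red-id n {suc j} _ j<n = cong suc (m<n⇒m%n≡m j<n)

red-n+ : ∀ n .{{_ : NonZero n}} {j} → 1 ≤ j → red n (n + j) ≡ red n j
red-n+ n {suc j} _ = begin
  suc ((n + suc j ∸ 1) % n)  ≡⟨ cong (λ x → suc ((x ∸ 1) % n)) (+-suc n j) ⟩
  suc ((n + j) % n)          ≡⟨ cong (λ x → suc (x % n)) (+-comm n j) ⟩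
  suc ((j + n) % n)          ≡⟨ cong suc ([m+n]%n≡m%n j n) ⟩
  suc (j % n)                ∎
  where open ≡-Reasoning

red-n+-id : ∀ n .{{_ : NonZero n}} {s} → 1 ≤ s → s ≤ n → red n (n + s) ≡ s
red-n+-id n 1≤s s≤n = trans (red-n+ n 1≤s) (red-id n 1≤s s≤n)

red-n+-≢ : ∀ n .{{_ : NonZero n}} {s s′} → s′ < s → s < n → s ≢ red n (n + s′)
red-n+-≢ n {s} {zero}    _    s<n s≡ =
  <-irrefl (trans s≡ (trans (cong (red n) (+-identityʳ n)) (red-id n (≤-trans (s≤s z≤n) s<n) ≤-refl))) s<n
red-n+-≢ n {s} {suc s′} s′<s s<n s≡ =
  <-irrefl (sym (trans s≡ (red-n+-id n (s≤s z≤n) (<⇒≤ (<-trans s′<s s<n))))) s′<s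

c-red : ∀ n .{{_ : NonZero n}} i j j′ → red n j ≡ red n j′ → c n i j ≗ c n i j′
c-red n i j j′ e p rewrite e = refl

module _ (n : ℕ) .{{_ : NonZero n}} where

  rowCoord-bound : ∀ {i} → i < n → i < suc (2 * n)
  rowCoord-bound i<n = s≤s (≤-trans (<⇒≤ i<n) (m≤m+n n (n + 0)))

  rowCoord : ∀ i → 1 ≤ i → i ≤ n → Fin (suc (2 * n))
  rowCoord (suc i) _ i<n = fromℕ< (rowCoord-bound i<n)

  c-rowCoord : ∀ r j i (1≤i : 1 ≤ i) (i≤n : i ≤ n) → c n r j (rowCoord i 1≤i i≤n) ≡ ind (i ≡ᵇ r)
  c-rowCoord r j (suc i) _ i<n rewrite toℕ-fromℕ< (rowCoord-bound i<n) | dec-true (suc i ≤? n) i<n = refl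

  colCoord-bound : ∀ t → suc t < n → n + t < suc (2 * n)
  colCoord-bound t s<n = s≤s (+-monoʳ-≤ n (≤-trans (≤-trans (n≤1+n t) (<⇒≤ s<n)) (m≤m+n n 0)))

  colCoord : ∀ s → 1 ≤ s → s < n → Fin (suc (2 * n))
  colCoord (suc t) _ s<n = fromℕ< (colCoord-bound t s<n)

  colCoord-inRange : ∀ t → suc t < n → suc (n + t) ≤ 2 * n ∸ 1
  colCoord-inRange t s<n = m+n≤o⇒m≤o∸n (suc (n + t)) (begin
    suc (n + t) + 1    ≡⟨ +-comm (suc (n + t)) 1 ⟩
    suc (suc (n + t))  ≡⟨ cong suc (+-suc n t) ⟨
    suc (n + suc t)    ≡⟨ +-suc n (suc t) ⟨
    n + suc (suc t)    ≤⟨ +-monoʳ-≤ n (≤-trans s<n (≤-reflexive (sym (+-identityʳ n)))) ⟩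
    2 * n              ∎)
    where open ≤-Reasoning

  c-colCoord : ∀ r j s (1≤s : 1 ≤ s) (s<n : s < n) → c n r j (colCoord s 1≤s s<n) ≡ ind (s ≡ᵇ red n j)
  c-colCoord r j (suc t) _ s<n
    rewrite toℕ-fromℕ< (colCoord-bound t s<n)
          | dec-false (suc (n + t) ≤? n) (<⇒≱ (s≤s (m≤m+n n t)))
          | dec-true (suc (n + t) ≤? 2 * n ∸ 1) (colCoord-inRange t s<n)
    = cong (λ x → ind (x ≡ᵇ red n j)) (trans (cong (_∸ n) (sym (+-suc n t))) (m+n∸m≡n n (suc t)))

c-row-≢ : ∀ n .{{_ : NonZero n}} {i i′} → 1 ≤ i → i ≤ n → i ≢ i′ →
  ∀ j j′ → ¬ (c n i j ≗ c n i′ j′)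
c-row-≢ n {i} {i′} 1≤i i≤n i≢i′ j j′ cij≗ci′j′ = 1≢0 (begin
  1ℚ                ≡⟨ ind-≡ {i} refl ⟨
  ind (i ≡ᵇ i)      ≡⟨ c-rowCoord n i j i 1≤i i≤n ⟨
  c n i j p         ≡⟨ cij≗ci′j′ p ⟩
  c n i′ j′ p       ≡⟨ c-rowCoord n i′ j′ i 1≤i i≤n ⟩
  ind (i ≡ᵇ i′)     ≡⟨ ind-≢ i≢i′ ⟩
  0ℚ                ∎)
  where
  open ≡-Reasoning
  p = rowCoord n i 1≤i i≤n
  1≢0 : 1ℚ ≢ 0ℚ
  1≢0 ()

⌈n/2⌉≡⌊n/2⌋⊎1+⌊n/2⌋ : ∀ z → ⌈ z /2⌉ ≡ ⌊ z /2⌋ ⊎ ⌈ z /2⌉ ≡ suc ⌊ z /2⌋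
⌈n/2⌉≡⌊n/2⌋⊎1+⌊n/2⌋ zero          = inj₁ refl
⌈n/2⌉≡⌊n/2⌋⊎1+⌊n/2⌋ (suc zero)    = inj₂ refl
⌈n/2⌉≡⌊n/2⌋⊎1+⌊n/2⌋ (suc (suc z)) = Sum.map (cong suc) (cong suc) (⌈n/2⌉≡⌊n/2⌋⊎1+⌊n/2⌋ z)

m≤n+n⇒⌈m/2⌉≤n : ∀ {m n} → m ≤ n + n → ⌈ m /2⌉ ≤ n
m≤n+n⇒⌈m/2⌉≤n {m} {n} m≤2n = ≤-trans (⌈n/2⌉-mono m≤2n) (≤-reflexive (sym (n≡⌈n+n/2⌉ n)))

⌈m/2⌉≤n⇒m≤n+n : ∀ {m n} → ⌈ m /2⌉ ≤ n → m ≤ n + n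
⌈m/2⌉≤n⇒m≤n+n {m} {n} ⌈m/2⌉≤n = begin
  m                      ≡⟨ ⌊n/2⌋+⌈n/2⌉≡n m ⟨
  ⌊ m /2⌋ + ⌈ m /2⌉      ≤⟨ +-mono-≤ (≤-trans (⌊n/2⌋≤⌈n/2⌉ m) ⌈m/2⌉≤n) ⌈m/2⌉≤n ⟩
  n + n                  ∎
  where open ≤-Reasoning

swap : ℕ → ℕ → ℕ → ℕ
swap a b i with i ≟ a | i ≟ b
... | yes _ | _     = b
... | no _  | yes _ = a
... | no _  | no _  = i

swap-cases : ∀ a b i →
  (i ≡ a × swap a b i ≡ b) ⊎ (i ≡ b × swap a b i ≡ a) ⊎ (i ≢ a × i ≢ b × swap a b i ≡ i)
swap-cases a b i with i ≟ a | i ≟ b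
... | yes i≡a | _       = inj₁ (i≡a , refl)
... | no _    | yes i≡b = inj₂ (inj₁ (i≡b , refl))
... | no i≢a  | no i≢b  = inj₂ (inj₂ (i≢a , i≢b , refl))

swap-left : ∀ a b → swap a b a ≡ b
swap-left a b with a ≟ a | a ≟ b
... | yes _   | _ = refl
... | no a≢a  | _ = contradiction refl a≢a

swap-right : ∀ {a b} → a ≢ b → swap a b b ≡ a
swap-right {a} {b} a≢b with b ≟ a | b ≟ b
... | yes b≡a | _       = contradiction (sym b≡a) a≢b
... | no _    | yes _   = refl
... | no _    | no b≢b  = contradiction refl b≢b

swap-other : ∀ {a b i} → i ≢ a → i ≢ b → swap a b i ≡ i
swap-other {a} {b} {i} i≢a i≢b with i ≟ a | i ≟ b
... | yes i≡a | _       = contradiction i≡a i≢a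
... | no _    | yes i≡b = contradiction i≡b i≢b
... | no _    | no _    = refl

swap-closed : ∀ (P : ℕ → Set) {a b} i → P a → P b → P i → P (swap a b i)
swap-closed P {a} {b} i Pa Pb Pi with i ≟ a | i ≟ b
... | yes _ | _     = Pb
... | no _  | yes _ = Pa
... | no _  | no _  = Pi

swap-involutive : ∀ {a b} → a ≢ b → ∀ i → swap a b (swap a b i) ≡ i
swap-involutive {a} {b} a≢b i with i ≟ a | i ≟ b
... | yes refl | _        = swap-right a≢b
... | no _     | yes refl = swap-left a b
... | no i≢a   | no i≢b   = swap-other i≢a i≢b

swap-injective : ∀ {a b} → a ≢ b → ∀ {i j} → swap a b i ≡ swap a b j → i ≡ j
swap-injective a≢b {i} {j} e =
  trans (sym (swap-involutive a≢b i)) (trans (cong (swap _ _) e) (swap-involutive a≢b j))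

even⊎odd : ∀ n → ∃ λ k → n ≡ k * 2 ⊎ n ≡ suc (k * 2)
even⊎odd zero          = 0 , inj₁ refl
even⊎odd (suc zero)    = 0 , inj₂ refl
even⊎odd (suc (suc n)) with even⊎odd n
... | k , n≡ = suc k , Sum.map (cong (2 +_)) (cong (2 +_)) n≡

half-even : ∀ k → half (k * 2) ≡ k
half-even k = begin
  (k * 2 + 1 ∸ (1 ∸ k * 2 % 2)) / 2  ≡⟨ cong (λ r → (k * 2 + 1 ∸ (1 ∸ r)) / 2) (m*n%n≡0 k 2) ⟩
  (k * 2 + 1 ∸ 1) / 2                ≡⟨ cong (_/ 2) (m+n∸n≡m (k * 2) 1) ⟩
  k * 2 / 2                          ≡⟨ m*n/n≡m k 2 ⟩
  k                                  ∎
  where open ≡-Reasoning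

half-odd : ∀ k → half (suc (k * 2)) ≡ suc k
half-odd k = begin
  (suc (k * 2) + 1 ∸ (1 ∸ suc (k * 2) % 2)) / 2
    ≡⟨ cong (λ r → (suc (k * 2) + 1 ∸ (1 ∸ r)) / 2) ([m+kn]%n≡m%n 1 k 2) ⟩
  (suc (k * 2) + 1) / 2
    ≡⟨ cong (_/ 2) (+-comm (suc (k * 2)) 1) ⟩
  suc k * 2 / 2
    ≡⟨ m*n/n≡m (suc k) 2 ⟩
  suc k ∎
  where open ≡-Reasoning

bigN-even : ∀ k → bigN (k * 2) ≡ k ∸ 2
bigN-even zero    = refl
bigN-even (suc k) = begin
  (suc (k * 2) + (1 ∸ suc (suc (k * 2)) % 2)) / 2 ∸ 2
    ≡⟨ cong (λ r → (suc (k * 2) + (1 ∸ r)) / 2 ∸ 2) (m*n%n≡0 (suc k) 2) ⟩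
  (suc (k * 2) + 1) / 2 ∸ 2
    ≡⟨ cong (λ m → m / 2 ∸ 2) (+-comm (suc (k * 2)) 1) ⟩
  suc k * 2 / 2 ∸ 2
    ≡⟨ cong (_∸ 2) (m*n/n≡m (suc k) 2) ⟩
  suc k ∸ 2 ∎
  where open ≡-Reasoning

bigN-odd : ∀ k → bigN (suc (k * 2)) ≡ k ∸ 2
bigN-odd k = begin
  (k * 2 + (1 ∸ suc (k * 2) % 2)) / 2 ∸ 2
    ≡⟨ cong (λ r → (k * 2 + (1 ∸ r)) / 2 ∸ 2) ([m+kn]%n≡m%n 1 k 2) ⟩
  (k * 2 + 0) / 2 ∸ 2
    ≡⟨ cong (λ m → m / 2 ∸ 2) (+-identityʳ (k * 2)) ⟩
  k * 2 / 2 ∸ 2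
    ≡⟨ cong (_∸ 2) (m*n/n≡m k 2) ⟩
  k ∸ 2 ∎
  where open ≡-Reasoning

m+m≡m*2 : ∀ m → m + m ≡ m * 2
m+m≡m*2 m = trans (cong (m +_) (sym (+-identityʳ m))) (*-comm 2 m)

1≤m∸2⇒m∸2+2≡m : ∀ {m} → 1 ≤ m ∸ 2 → m ∸ 2 + 2 ≡ m
1≤m∸2⇒m∸2+2≡m {m} 1≤m∸2 = m∸n+n≡m (<⇒≤ (m∸n≢0⇒n<m {m} {2} (>⇒≢ 1≤m∸2)))

bigN+2≤half×half+[bigN+2]≡n : ∀ n → 1 ≤ bigN n → bigN n + 2 ≤ half n × half n + (bigN n + 2) ≡ n
bigN+2≤half×half+[bigN+2]≡n n 1≤N with even⊎odd n
... | k , inj₁ refl rewrite half-even k | bigN-even k =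
  ≤-reflexive (1≤m∸2⇒m∸2+2≡m 1≤N) , trans (cong (k +_) (1≤m∸2⇒m∸2+2≡m 1≤N)) (m+m≡m*2 k)
... | k , inj₂ refl rewrite half-odd k | bigN-odd k =
  ≤-trans (≤-reflexive (1≤m∸2⇒m∸2+2≡m 1≤N)) (n≤1+n k) ,
  cong suc (trans (cong (k +_) (1≤m∸2⇒m∸2+2≡m 1≤N)) (m+m≡m*2 k))

rows-ordered : ∀ n ℓ → 1 ≤ ℓ → ℓ ≤ bigN n →
  2 * ℓ + 2 ≤ n × 1 ≤ i₁ n ℓ × i₁ n ℓ < n ∸ 2 * ℓ ∸ 1 × n ∸ 2 * ℓ ∸ 1 < i₂ n ℓ × i₂ n ℓ ≤ n
rows-ordered n ℓ 1≤ℓ ℓ≤N = 2ℓ+2≤n , 1≤i₁ , i₁<i₀ , i₀<i₂ , m∸n≤m n ℓ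
  where
  h = half n
  N+2≤h : bigN n + 2 ≤ h
  N+2≤h = proj₁ (bigN+2≤half×half+[bigN+2]≡n n (≤-trans 1≤ℓ ℓ≤N))
  h+N+2≡n : h + (bigN n + 2) ≡ n
  h+N+2≡n = proj₂ (bigN+2≤half×half+[bigN+2]≡n n (≤-trans 1≤ℓ ℓ≤N))
  ℓ+2≤h : ℓ + 2 ≤ h
  ℓ+2≤h = ≤-trans (+-monoˡ-≤ 2 ℓ≤N) N+2≤h
  ℓ≤h : ℓ ≤ h
  ℓ≤h = ≤-trans (m≤m+n ℓ 2) ℓ+2≤h
  h+ℓ+2≤n : h + (ℓ + 2) ≤ n
  h+ℓ+2≤n = ≤-trans (+-monoʳ-≤ h (+-monoˡ-≤ 2 ℓ≤N)) (≤-reflexive h+N+2≡n)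
  2ℓ+1<n : 2 * ℓ + 1 < n
  2ℓ+1<n = ≤-trans (≤-reflexive (shape ℓ)) (≤-trans (+-monoˡ-≤ (ℓ + 2) ℓ≤h) h+ℓ+2≤n)
    where
    shape : ∀ ℓ → suc (2 * ℓ + 1) ≡ ℓ + (ℓ + 2)
    shape = solve-∀
  2ℓ+2≤n : 2 * ℓ + 2 ≤ n
  2ℓ+2≤n = subst (_≤ n) (sym (+-suc (2 * ℓ) 1)) 2ℓ+1<n
  1≤i₁ : 1 ≤ h ∸ ℓ
  1≤i₁ = m+n≤o⇒m≤o∸n 1 (≤-trans (≤-trans (n≤1+n (suc ℓ)) (≤-reflexive (+-comm 2 ℓ))) ℓ+2≤h)
  i₀≡ : n ∸ 2 * ℓ ∸ 1 ≡ n ∸ (2 * ℓ + 1)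
  i₀≡ = ∸-+-assoc n (2 * ℓ) 1
  i₁<i₀ : h ∸ ℓ < n ∸ 2 * ℓ ∸ 1
  i₁<i₀ = subst (h ∸ ℓ <_) (sym i₀≡) (m+n≤o⇒m≤o∸n (suc (h ∸ ℓ)) (≤-trans (≤-reflexive eq) h+ℓ+2≤n))
    where
    shape : ∀ x ℓ → suc x + (2 * ℓ + 1) ≡ x + ℓ + (ℓ + 2)
    shape = solve-∀
    eq : suc (h ∸ ℓ) + (2 * ℓ + 1) ≡ h + (ℓ + 2)
    eq = trans (shape (h ∸ ℓ) ℓ) (cong (_+ (ℓ + 2)) (m∸n+n≡m ℓ≤h))
  i₀<i₂ : n ∸ 2 * ℓ ∸ 1 < n ∸ ℓ
  i₀<i₂ = subst (_< n ∸ ℓ) (sym i₀≡) (∸-monoʳ-< ℓ<2ℓ+1 (<⇒≤ 2ℓ+1<n))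
    where
    ℓ<2ℓ+1 : ℓ < 2 * ℓ + 1
    ℓ<2ℓ+1 = ≤-trans (s≤s (m≤m+n ℓ (ℓ + 0))) (≤-reflexive (+-comm 1 (2 * ℓ)))

module SwappedPath (n : ℕ) .{{_ : NonZero n}} (ℓ : ℕ) (2ℓ+2≤n : 2 * ℓ + 2 ≤ n)
  (1≤i₁ : 1 ≤ i₁ n ℓ) (i₁<i₀ : i₁ n ℓ < n ∸ 2 * ℓ ∸ 1)
  (i₀<i₂ : n ∸ 2 * ℓ ∸ 1 < i₂ n ℓ) (i₂≤n : i₂ n ℓ ≤ n)
  where

  L : ℕ
  L = 2 * ℓ

  i₀ : ℕ
  i₀ = n ∸ L ∸ 1

  σ : ℕ → ℕ
  σ = swap (i₁ n ℓ) (i₂ n ℓ)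

  i₁<i₂ : i₁ n ℓ < i₂ n ℓ
  i₁<i₂ = <-trans i₁<i₀ i₀<i₂

  i₁≤n : i₁ n ℓ ≤ n
  i₁≤n = ≤-trans (<⇒≤ i₁<i₂) i₂≤n

  1≤i₂ : 1 ≤ i₂ n ℓ
  1≤i₂ = ≤-trans 1≤i₁ (<⇒≤ i₁<i₂)

  i₁≢i₂ : i₁ n ℓ ≢ i₂ n ℓ
  i₁≢i₂ = <⇒≢ i₁<i₂

  i₁≢i₀ : i₁ n ℓ ≢ i₀
  i₁≢i₀ = <⇒≢ i₁<i₀

  i₂≢i₀ : i₂ n ℓ ≢ i₀
  i₂≢i₀ = >⇒≢ i₀<i₂

  L<n : L < n
  L<n = <-≤-trans (m<m+n L (s≤s z≤n)) 2ℓ+2≤n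

  L+1<n : L + 1 < n
  L+1<n = subst (_≤ n) (+-suc L 1) 2ℓ+2≤n

  i₀+L+1≡n : i₀ + L + 1 ≡ n
  i₀+L+1≡n = begin
    n ∸ L ∸ 1 + L + 1       ≡⟨ cong (λ x → x + L + 1) (∸-+-assoc n L 1) ⟩
    n ∸ (L + 1) + L + 1     ≡⟨ +-assoc (n ∸ (L + 1)) L 1 ⟩
    n ∸ (L + 1) + (L + 1)   ≡⟨ m∸n+n≡m (<⇒≤ L+1<n) ⟩
    n                       ∎
    where open ≡-Reasoning

  -- ρ t is the row i with i + 2ℓ ≡ t (mod n): the path B̃_ℓ, started at column n, reaches
  -- its rows in the order ρ 0, ρ 1, …, ρ (n ∸ 1).
  ρ : ℕ → ℕ
  ρ t with L <? t
  ... | yes _ = t ∸ L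
  ... | no  _ = n + t ∸ L

  ρ-spec : ∀ t → (L < t × ρ t + L ≡ t) ⊎ (t ≤ L × ρ t + L ≡ n + t)
  ρ-spec t with L <? t
  ... | yes L<t = inj₁ (L<t , m∸n+n≡m (<⇒≤ L<t))
  ... | no  L≮t = inj₂ (≮⇒≥ L≮t , m∸n+n≡m (≤-trans (<⇒≤ L<n) (m≤m+n n t)))

  ρ-unique : ∀ {t i} → (L < t × i + L ≡ t) ⊎ (t ≤ L × i + L ≡ n + t) → ρ t ≡ i
  ρ-unique {t} {i} spec with ρ-spec t | spec
  ... | inj₁ (_ , e)     | inj₁ (_ , e′)     = +-cancelʳ-≡ L (ρ t) i (trans e (sym e′))
  ... | inj₂ (_ , e)     | inj₂ (_ , e′)     = +-cancelʳ-≡ L (ρ t) i (trans e (sym e′))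
  ... | inj₁ (L<t , _)   | inj₂ (t≤L , _)   = contradiction t≤L (<⇒≱ L<t)
  ... | inj₂ (t≤L , _)   | inj₁ (L<t , _)   = contradiction t≤L (<⇒≱ L<t)

  ρ-range : ∀ {t} → t < n → 1 ≤ ρ t × ρ t ≤ n
  ρ-range {t} t<n with ρ-spec t
  ... | inj₁ (L<t , e) =
    +-cancelʳ-< L 0 (ρ t) (subst (L <_) (sym e) L<t) ,
    ≤-trans (m≤m+n (ρ t) L) (≤-trans (≤-reflexive e) (<⇒≤ t<n))
  ... | inj₂ (t≤L , e) =
    +-cancelʳ-< L 0 (ρ t) (subst (L <_) (sym e) (≤-trans L<n (m≤m+n n t))) ,
    +-cancelʳ-≤ L (ρ t) n (subst (_≤ n + L) (sym e) (+-monoʳ-≤ n t≤L))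

  ρ-injective : ∀ {t t′} → t < n → t′ < n → ρ t ≡ ρ t′ → t ≡ t′
  ρ-injective {t} {t′} t<n t′<n e with ρ-spec t | ρ-spec t′
  ... | inj₁ (_ , et) | inj₁ (_ , et′) = trans (sym et) (trans (cong (_+ L) e) et′)
  ... | inj₂ (_ , et) | inj₂ (_ , et′) = +-cancelˡ-≡ n t t′ (trans (sym et) (trans (cong (_+ L) e) et′))
  ... | inj₁ (_ , et) | inj₂ (_ , et′) =
    contradiction (≤-trans (m≤m+n n t′) (≤-reflexive (trans (sym et′) (trans (cong (_+ L) (sym e)) et)))) (<⇒≱ t<n)
  ... | inj₂ (_ , et) | inj₁ (_ , et′) =
    contradiction (≤-trans (m≤m+n n t) (≤-reflexive (trans (sym et) (trans (cong (_+ L) e) et′)))) (<⇒≱ t′<n)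

  ρ-surjective : ∀ {i} → 1 ≤ i → i ≤ n → ∃ λ t → t < n × ρ t ≡ i
  ρ-surjective {i} 1≤i i≤n with L + i <? n
  ... | yes L+i<n = L + i , L+i<n , ρ-unique (inj₁ (m<m+n L 1≤i , +-comm i L))
  ... | no  L+i≮n = L + i ∸ n , ≤-<-trans t≤L L<n , ρ-unique (inj₂ (t≤L , i+L≡n+t))
    where
    t≤L : L + i ∸ n ≤ L
    t≤L = subst (L + i ∸ n ≤_) (m+n∸n≡m L n) (∸-monoˡ-≤ n (+-monoʳ-≤ L i≤n))
    i+L≡n+t : i + L ≡ n + (L + i ∸ n)
    i+L≡n+t = trans (+-comm i L) (sym (m+[n∸m]≡n (≮⇒≥ L+i≮n)))

  ρ-last : ρ (n ∸ 1) ≡ i₀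
  ρ-last = ρ-unique (inj₁ (m+n≤o⇒m≤o∸n (suc L) L+1<n , i₀+L≡n∸1))
    where
    i₀+L≡n∸1 : i₀ + L ≡ n ∸ 1
    i₀+L≡n∸1 = trans (sym (m+n∸n≡m (i₀ + L) 1)) (cong (_∸ 1) i₀+L+1≡n)

  1+[n∸1]≡n : suc (n ∸ 1) ≡ n
  1+[n∸1]≡n = trans (+-comm 1 (n ∸ 1)) (m∸n+n≡m (≤-trans (s≤s z≤n) L<n))

  1+t<n⇒ρt≢i₀ : ∀ {t} → suc t < n → ρ t ≢ i₀
  1+t<n⇒ρt≢i₀ {t} 1+t<n ρt≡i₀ = <-irrefl (trans (cong suc t≡n∸1) 1+[n∸1]≡n) 1+t<n
    where
    t≡n∸1 : t ≡ n ∸ 1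
    t≡n∸1 = ρ-injective (<-trans (n<1+n t) 1+t<n) (≤-reflexive 1+[n∸1]≡n) (trans ρt≡i₀ (sym ρ-last))

  ρt≢i₀⇒1+t<n : ∀ {t} → t < n → ρ t ≢ i₀ → suc t < n
  ρt≢i₀⇒1+t<n t<n ρt≢i₀ = ≤∧≢⇒< t<n (λ 1+t≡n → ρt≢i₀ (trans (cong (ρ ∘ (_∸ 1)) 1+t≡n) ρ-last))

  red-ρ : ∀ t → red n (n + t) ≡ red n (ρ t + L)
  red-ρ t with ρ-spec t
  ... | inj₁ (L<t , e) = trans (red-n+ n (≤-trans (s≤s z≤n) L<t)) (cong (red n) (sym e))
  ... | inj₂ (_ , e)   = cong (red n) (sym e)

  red-ρ+1 : ∀ t → red n (n + suc t) ≡ red n (ρ t + L + 1)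
  red-ρ+1 t with ρ-spec t
  ... | inj₁ (_ , e) = trans (red-n+ n (s≤s z≤n)) (cong (red n) (trans (+-comm 1 t) (cong (_+ 1) (sym e))))
  ... | inj₂ (_ , e) = cong (red n) (trans (trans (+-suc n t) (+-comm 1 (n + t))) (cong (_+ 1) (sym e)))

  Edge : V n → Set
  Edge v = ∃ λ i → 1 ≤ i × i ≤ n ×
    (v ≗ c n (σ i) (i + L) ⊎ (i ≢ i₀ × v ≗ c n (σ i) (i + L + 1)))

  straight-edge⇒B : ∀ {v i} → 1 ≤ i → i ≤ n → v ≗ c n (σ i) (i + L) → B n ℓ v
  straight-edge⇒B {v} {i} 1≤i i≤n v≗ with swap-cases (i₁ n ℓ) (i₂ n ℓ) i
  ... | inj₁ (refl , σi≡i₂) =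
    inj₂ (inj₂ (inj₂ (inj₁ (subst (λ r → v ≗ c n r (i + L)) σi≡i₂ v≗))))
  ... | inj₂ (inj₁ (refl , σi≡i₁)) =
    inj₂ (inj₁ (subst (λ r → v ≗ c n r (i + L)) σi≡i₁ v≗))
  ... | inj₂ (inj₂ (i≢i₁ , i≢i₂ , σi≡i)) =
    inj₁ (inj₁ (i , 1≤i , i≤n , v≗cii) ,
          other-row (i₁ n ℓ + L) i≢i₁ , other-row (i₁ n ℓ + L + 1) i≢i₁ ,
          other-row (i₂ n ℓ + L) i≢i₂ , other-row (i₂ n ℓ + L + 1) i≢i₂)
    where
    v≗cii : v ≗ c n i (i + L)
    v≗cii = subst (λ r → v ≗ c n r (i + L)) σi≡i v≗
    other-row : ∀ {i′} j′ → i ≢ i′ → ¬ (v ≗ c n i′ j′)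
    other-row j′ i≢i′ v≗ = c-row-≢ n 1≤i i≤n i≢i′ (i + L) j′ (λ p → trans (sym (v≗cii p)) (v≗ p))

  shifted-edge⇒B : ∀ {v i} → 1 ≤ i → i ≤ n → i ≢ i₀ → v ≗ c n (σ i) (i + L + 1) → B n ℓ v
  shifted-edge⇒B {v} {i} 1≤i i≤n i≢i₀ v≗ with swap-cases (i₁ n ℓ) (i₂ n ℓ) i
  ... | inj₁ (refl , σi≡i₂) =
    inj₂ (inj₂ (inj₂ (inj₂ (subst (λ r → v ≗ c n r (i + L + 1)) σi≡i₂ v≗))))
  ... | inj₂ (inj₁ (refl , σi≡i₁)) =
    inj₂ (inj₂ (inj₁ (subst (λ r → v ≗ c n r (i + L + 1)) σi≡i₁ v≗)))
  ... | inj₂ (inj₂ (i≢i₁ , i≢i₂ , σi≡i)) =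
    inj₁ (inj₂ (i , 1≤i , i≤n , v≗cii , other-row n i≢i₀) ,
          other-row (i₁ n ℓ + L) i≢i₁ , other-row (i₁ n ℓ + L + 1) i≢i₁ ,
          other-row (i₂ n ℓ + L) i≢i₂ , other-row (i₂ n ℓ + L + 1) i≢i₂)
    where
    v≗cii : v ≗ c n i (i + L + 1)
    v≗cii = subst (λ r → v ≗ c n r (i + L + 1)) σi≡i v≗
    other-row : ∀ {i′} j′ → i ≢ i′ → ¬ (v ≗ c n i′ j′)
    other-row j′ i≢i′ v≗ = c-row-≢ n 1≤i i≤n i≢i′ (i + L + 1) j′ (λ p → trans (sym (v≗cii p)) (v≗ p))

  edge⇒B : ∀ {v} → Edge v → B n ℓ v
  edge⇒B (i , 1≤i , i≤n , inj₁ v≗)          = straight-edge⇒B 1≤i i≤n v≗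
  edge⇒B (i , 1≤i , i≤n , inj₂ (i≢i₀ , v≗)) = shifted-edge⇒B 1≤i i≤n i≢i₀ v≗

  B⇒edge : ∀ {v} → B n ℓ v → Edge v
  B⇒edge {v} (inj₁ (inj₁ (i , 1≤i , i≤n , v≗) , v≉i₁ , _ , v≉i₂ , _)) =
    i , 1≤i , i≤n , inj₁ (subst (λ r → v ≗ c n r (i + L)) (sym (swap-other i≢i₁ i≢i₂)) v≗)
    where
    i≢i₁ : i ≢ i₁ n ℓ
    i≢i₁ i≡i₁ = v≉i₁ (subst (λ r → v ≗ c n r (r + L)) i≡i₁ v≗)
    i≢i₂ : i ≢ i₂ n ℓ
    i≢i₂ i≡i₂ = v≉i₂ (subst (λ r → v ≗ c n r (r + L)) i≡i₂ v≗)
  B⇒edge {v} (inj₁ (inj₂ (i , 1≤i , i≤n , v≗ , v≉excluded) , _ , v≉i₁ , _ , v≉i₂)) =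
    i , 1≤i , i≤n , inj₂ (i≢i₀ , subst (λ r → v ≗ c n r (i + L + 1)) (sym (swap-other i≢i₁ i≢i₂)) v≗)
    where
    i≢i₁ : i ≢ i₁ n ℓ
    i≢i₁ i≡i₁ = v≉i₁ (subst (λ r → v ≗ c n r (r + L + 1)) i≡i₁ v≗)
    i≢i₂ : i ≢ i₂ n ℓ
    i≢i₂ i≡i₂ = v≉i₂ (subst (λ r → v ≗ c n r (r + L + 1)) i≡i₂ v≗)
    i≢i₀ : i ≢ i₀
    i≢i₀ i≡i₀ =
      v≉excluded (subst (λ j → v ≗ c n i₀ j) i₀+L+1≡n (subst (λ r → v ≗ c n r (r + L + 1)) i≡i₀ v≗))
  B⇒edge {v} (inj₂ (inj₁ v≗)) =
    i₂ n ℓ , 1≤i₂ , i₂≤n , inj₁ (subst (λ r → v ≗ c n r (i₂ n ℓ + L)) (sym (swap-right i₁≢i₂)) v≗)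
  B⇒edge {v} (inj₂ (inj₂ (inj₁ v≗))) =
    i₂ n ℓ , 1≤i₂ , i₂≤n ,
    inj₂ (i₂≢i₀ , subst (λ r → v ≗ c n r (i₂ n ℓ + L + 1)) (sym (swap-right i₁≢i₂)) v≗)
  B⇒edge {v} (inj₂ (inj₂ (inj₂ (inj₁ v≗)))) =
    i₁ n ℓ , 1≤i₁ , i₁≤n ,
    inj₁ (subst (λ r → v ≗ c n r (i₁ n ℓ + L)) (sym (swap-left (i₁ n ℓ) (i₂ n ℓ))) v≗)
  B⇒edge {v} (inj₂ (inj₂ (inj₂ (inj₂ v≗)))) =
    i₁ n ℓ , 1≤i₁ , i₁≤n ,
    inj₂ (i₁≢i₀ , subst (λ r → v ≗ c n r (i₁ n ℓ + L + 1)) (sym (swap-left (i₁ n ℓ) (i₂ n ℓ))) v≗)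

  row : ℕ → ℕ
  row t = σ (ρ t)

  row-range : ∀ {t} → t < n → 1 ≤ row t × row t ≤ n
  row-range {t} t<n = swap-closed (λ r → 1 ≤ r × r ≤ n) (ρ t) (1≤i₁ , i₁≤n) (1≤i₂ , i₂≤n) (ρ-range t<n)

  row-injective : ∀ {t t′} → t < n → t′ < n → row t ≡ row t′ → t ≡ t′
  row-injective t<n t′<n = ρ-injective t<n t′<n ∘ swap-injective i₁≢i₂

  pathLength : ℕ
  pathLength = 2 * n ∸ 1

  -- Column t is written n + t, which c reads as column t for 1 ≤ t < n and as column n for t = 0.
  path : ℕ → V n
  path z = c n (row ⌊ z /2⌋) (n + ⌈ z /2⌉)

  1+pathLength≡n+n : suc pathLength ≡ n + n
  1+pathLength≡n+n = trans (+-comm 1 pathLength) (trans (m∸n+n≡m 1≤2n) (cong (n +_) (+-identityʳ n)))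
    where
    1≤2n : 1 ≤ 2 * n
    1≤2n = ≤-trans (≤-trans (s≤s z≤n) L<n) (m≤m+n n (n + 0))

  on-path⇒⌈z/2⌉<n : ∀ {z} → z < pathLength → ⌈ z /2⌉ < n
  on-path⇒⌈z/2⌉<n {z} z<M = m≤n+n⇒⌈m/2⌉≤n (subst (suc (suc z) ≤_) 1+pathLength≡n+n (s≤s z<M))

  ⌈z/2⌉<n⇒on-path : ∀ {z} → ⌈ z /2⌉ < n → z < pathLength
  ⌈z/2⌉<n⇒on-path {z} ⌈z/2⌉<n =
    s≤s⁻¹ (subst (suc (suc z) ≤_) (sym 1+pathLength≡n+n) (⌈m/2⌉≤n⇒m≤n+n ⌈z/2⌉<n))

  path-even : ∀ t → path (t + t) ≗ c n (row t) (ρ t + L)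
  path-even t rewrite sym (n≡⌊n+n/2⌋ t) | sym (n≡⌈n+n/2⌉ t) = c-red n (row t) (n + t) (ρ t + L) (red-ρ t)

  path-odd : ∀ t → path (suc (t + t)) ≗ c n (row t) (ρ t + L + 1)
  path-odd t rewrite sym (n≡⌊n+n/2⌋ t) | sym (n≡⌈n+n/2⌉ t) =
    c-red n (row t) (n + suc t) (ρ t + L + 1) (red-ρ+1 t)

  path-edge : ∀ {z} → z < pathLength → Edge (path z)
  path-edge {z} z<M with ⌈n/2⌉≡⌊n/2⌋⊎1+⌊n/2⌋ z
  ... | inj₁ s≡t =
    ρ t , proj₁ (ρ-range t<n) , proj₂ (ρ-range t<n) ,
    inj₁ (c-red n (row t) (n + ⌈ z /2⌉) (ρ t + L) (trans (cong (λ s → red n (n + s)) s≡t) (red-ρ t)))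
    where
    t = ⌊ z /2⌋
    t<n : t < n
    t<n = subst (_< n) s≡t (on-path⇒⌈z/2⌉<n z<M)
  ... | inj₂ s≡1+t =
    ρ t , proj₁ (ρ-range t<n) , proj₂ (ρ-range t<n) ,
    inj₂ (1+t<n⇒ρt≢i₀ 1+t<n ,
          c-red n (row t) (n + ⌈ z /2⌉) (ρ t + L + 1) (trans (cong (λ s → red n (n + s)) s≡1+t) (red-ρ+1 t)))
    where
    t = ⌊ z /2⌋
    1+t<n : suc t < n
    1+t<n = subst (_< n) s≡1+t (on-path⇒⌈z/2⌉<n z<M)
    t<n : t < n
    t<n = <-trans (n<1+n t) 1+t<n

  edge-on-path : ∀ {v} → Edge v → ∃ λ z → z < pathLength × v ≗ path z
  edge-on-path (i , 1≤i , i≤n , inj₁ v≗) with ρ-surjective 1≤i i≤n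
  ... | t , t<n , refl =
    t + t , ⌈z/2⌉<n⇒on-path (subst (_< n) (n≡⌈n+n/2⌉ t) t<n) , λ p → trans (v≗ p) (sym (path-even t p))
  edge-on-path (i , 1≤i , i≤n , inj₂ (i≢i₀ , v≗)) with ρ-surjective 1≤i i≤n
  ... | t , t<n , refl =
    suc (t + t) , ⌈z/2⌉<n⇒on-path (subst (λ s → suc s < n) (n≡⌊n+n/2⌋ t) (ρt≢i₀⇒1+t<n t<n i≢i₀)) ,
    λ p → trans (v≗ p) (sym (path-odd t p))

  path-pivot : ∀ {x} → x < pathLength → ∃ λ p → path x p ≡ 1ℚ × (∀ z → z < x → path z p ≡ 0ℚ)
  path-pivot {x} x<M with ⌈n/2⌉≡⌊n/2⌋⊎1+⌊n/2⌋ x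
  ... | inj₁ s≡t = p , trans (c-rowCoord n r (n + ⌈ x /2⌉) r 1≤r r≤n) (ind-≡ {r} refl) , earlier
    where
    t = ⌊ x /2⌋
    t<n : t < n
    t<n = subst (_< n) s≡t (on-path⇒⌈z/2⌉<n x<M)
    r = row t
    1≤r = proj₁ (row-range t<n)
    r≤n = proj₂ (row-range t<n)
    p = rowCoord n r 1≤r r≤n
    earlier : ∀ z → z < x → path z p ≡ 0ℚ
    earlier z z<x = trans (c-rowCoord n (row ⌊ z /2⌋) (n + ⌈ z /2⌉) r 1≤r r≤n)
      (ind-≢ λ r≡rowz → <-irrefl (sym (row-injective t<n (<-trans ⌊z/2⌋<t t<n) r≡rowz)) ⌊z/2⌋<t)
      where
      ⌊z/2⌋<t : ⌊ z /2⌋ < t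
      ⌊z/2⌋<t = ≤-trans (⌈n/2⌉-mono z<x) (≤-reflexive s≡t)
  ... | inj₂ s≡1+t =
    p , trans (c-colCoord n (row ⌊ x /2⌋) (n + s) s 1≤s s<n) (ind-≡ (sym (red-n+-id n 1≤s (<⇒≤ s<n)))) , earlier
    where
    s = ⌈ x /2⌉
    s<n : s < n
    s<n = on-path⇒⌈z/2⌉<n x<M
    1≤s : 1 ≤ s
    1≤s = subst (1 ≤_) (sym s≡1+t) (s≤s z≤n)
    p = colCoord n s 1≤s s<n
    earlier : ∀ z → z < x → path z p ≡ 0ℚ
    earlier z z<x =
      trans (c-colCoord n (row ⌊ z /2⌋) (n + ⌈ z /2⌉) s 1≤s s<n) (ind-≢ (red-n+-≢ n ⌈z/2⌉<s s<n))
      where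
      ⌈z/2⌉<s : ⌈ z /2⌉ < s
      ⌈z/2⌉<s = subst (⌈ z /2⌉ <_) (sym s≡1+t) (s≤s (⌊n/2⌋-mono z<x))

  spanDim : SpanDim n (B n ℓ) pathLength
  spanDim = linIndep-enumeration⇒spanDim n pathLength (B n ℓ) (path ∘ toℕ) independent
    (λ k → edge⇒B (path-edge (toℕ<n k))) covered
    where
    independent : LinIndep n pathLength (path ∘ toℕ)
    independent = linIndep-unitriangular n pathLength (path ∘ toℕ) λ k →
      let (p , pivot≡1 , earlier) = path-pivot (toℕ<n k) in p , pivot≡1 , λ k′ → earlier (toℕ k′)
    covered : ∀ v → B n ℓ v → ∃ λ k → v ≗ path (toℕ k)
    covered v Bv with edge-on-path (B⇒edge Bv)
    ... | z , z<M , v≗ = fromℕ< z<M , λ p → trans (v≗ p) (cong (λ z → path z p) (sym (toℕ-fromℕ< z<M)))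

-- The bound 8 ≤ n, the congruence condition on Z and the two excluded values of ℓ are not needed.
lemma6p4 : (n : ℕ) → .{{_ : NonZero n}} → 8 ≤ n →
    (Z : ℕ → Set) →
    (∀ ℓ → Z ℓ → 1 ≤ ℓ × ℓ ≤ bigN n) →
    (∀ m ℓ → Z m → Z ℓ → NotCong n m ℓ) →
    ∀ ℓ → Z ℓ → ¬ (ℓ ≡ n / 4) → ¬ (ℓ ≡ n / 4 + 1) →
    SpanDim n (B n ℓ) (2 * n ∸ 1)
lemma6p4 n _ _ ℓ-range _ ℓ ℓ∈Z _ _ =
  let (1≤ℓ , ℓ≤N) = ℓ-range ℓ ℓ∈Z
      (2ℓ+2≤n , 1≤i₁ , i₁<i₀ , i₀<i₂ , i₂≤n) = rows-ordered n ℓ 1≤ℓ ℓ≤N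
  in SwappedPath.spanDim n ℓ 2ℓ+2≤n 1≤i₁ i₁<i₀ i₀<i₂ i₂≤n
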